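{- For each pair of positive integers $r_0,\ell$ and each real $\epsilon>0$, there exists a positive integer $n$ such that every $\ell$-periodic string $s_1,\ldots,s_n$ (over any finite alphabet) contains a substring $t:=s_{i+1},\ldots,s_{i+2r}$ of length $2r\ge 2r_0$ with $\tau(t)\le \epsilon r$.
   Context: An alphabet is a finite non-empty set; a string over it is a finite sequence of its elements. For a string $u=u_1,\ldots,u_m$ and a character $a$, $\mathrm{hist}_a(u):=|\{i: u_i=a\}|$. For a string $t=t_1,\ldots,t_{2r}$ and a character $a$, let $\tau_a(t):=|\mathrm{hist}_a(t_1,\ldots,t_r)-\mathrm{hist}_a(t_{r+1},\ldots,t_{2r})|$, and $\tau(t):=\sum_a \tau_a(t)$, the sum over all characters appearing in $t$. A string $s=s_1,\ldots,s_n$ is \emph{$\ell$-periodic} if every substring of $s$ of length $\ell$ (consisting of $\ell$ consecutive entries) contains every character that appears anywhere in $s$.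
   Formalization: The parameter ε ranges over the positive rationals rather than over all positive reals. -}

module Defs where

open import Data.Nat using (ℕ; _+_; _*_; _≤_; ∣_-_∣)
open import Data.Fin using (Fin)
open import Data.Fin.Properties using (_≟_)
open import Data.List using (List; length; filter; take; drop; map; allFin)
open import Data.Nat.ListAction using (sum)
open import Data.List.Membership.Propositional using (_∈_)
open import Data.List.Relation.Unary.Any using (any?)
open import Relation.Binary.PropositionalEquality using (_≡_)

Str : ℕ → Set
Str k = List (Fin k)

hist : ∀ {k} → Fin k → Str k → ℕ
hist a u = length (filter (λ x → a ≟ x) u)

-- the substring s_{i+1},...,s_{i+m}
substr : ∀ {k} → ℕ → ℕ → Str k → Str k
substr i m s = take m (drop i s)

τₐ : ∀ {k} → ℕ → Fin k → Str k → ℕ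
τₐ r a t = ∣ hist a (take r t) - hist a (drop r t) ∣

τ : ∀ {k} → ℕ → Str k → ℕ
τ {k} r t = sum (map (λ a → τₐ r a t) (filter (λ a → any? (λ x → a ≟ x) t) (allFin k)))

Periodic : ∀ {k} → ℕ → Str k → Set
Periodic ℓ s = ∀ i → i + ℓ ≤ length s → ∀ a → a ∈ s → a ∈ substr i ℓ s

-- The energy of a window is Σₐ histₐ², and splitting a window of length 2L into halves, the
-- parallelogram law gives  energy(2L) + Σₐ τₐ² = 2·energy(left) + 2·energy(right).  As
-- energy(L) ≤ L², the normalised energy c·energy/L² lies in [0, c], and doubling a window that
-- is unbalanced (c·Σₐ τₐ² ≥ d·L²) drops it by d/4 below the average of the halves.  So among the
-- dyadic subwindows of a string of length 2^(4c+1)·W some window of length ≥ W is balanced.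
-- For c = q²ℓ and d = p² balance gives q·τ ≤ p·r by Cauchy–Schwarz, since by periodicity at
-- most ℓ characters occur.

module Submission where

open import Defs
open import Data.Nat using (ℕ; zero; suc; _+_; _*_; _^_; _≤_; _<_; z≤n; s≤s; ∣_-_∣; NonZero; >-nonZero; >-nonZero⁻¹)
open import Data.Nat.Properties hiding (_≟_)
open import Data.Nat.ListAction using (sum)
open import Data.Nat.Tactic.RingSolver using (solve)
open import Data.Fin using (Fin; zero; suc)
open import Data.Fin.Properties using (_≟_)
open import Data.List using (List; []; _∷_; _++_; length; filter; take; drop; map; allFin; tabulate)
open import Data.List.Properties
  using (length-++; filter-++; map-cong; map-tabulate; tabulate-cong; take-take; take-drop; take++drop≡id; drop-drop; length-take)
open import Data.List.Membership.Propositional using (_∈_)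
open import Data.List.Relation.Unary.Any using (here; there; any?)
open import Data.List.Relation.Binary.Subset.Propositional using (_⊆_)
import Data.List.Relation.Binary.Sublist.Propositional as Sublist
open import Data.List.Relation.Binary.Sublist.Propositional.Properties using (take-⊆; drop-⊆)
open import Data.Product using (Σ; _×_; _,_)
open import Data.Sum using (_⊎_; inj₁; inj₂)
open import Data.Empty using (⊥-elim)
open import Function using (_∘′_)
open import Relation.Nullary using (yes; no)
open import Relation.Unary using (Pred; Decidable)
open import Relation.Binary.PropositionalEquality
open import Level using (0ℓ)
open import Algebra.Properties.CommutativeSemigroup +-commutativeSemigroup using (interchange)

sum-of-squares-≤ : ∀ {x y} → x ≤ y → x * x + y * y ≡ 2 * (x * y) + ∣ x - y ∣ * ∣ x - y ∣
sum-of-squares-≤ {x} x≤y with d , refl ← m≤n⇒∃[o]m+o≡n x≤y rewrite ∣m-m+n∣≡n x d =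
  solve (x ∷ d ∷ [])

sum-of-squares : ∀ x y → x * x + y * y ≡ 2 * (x * y) + ∣ x - y ∣ * ∣ x - y ∣
sum-of-squares x y with ≤-total x y
... | inj₁ x≤y = sum-of-squares-≤ x≤y
... | inj₂ y≤x = begin
  x * x + y * y                                ≡⟨ +-comm (x * x) (y * y) ⟩
  y * y + x * x                                ≡⟨ sum-of-squares-≤ y≤x ⟩
  2 * (y * x) + ∣ y - x ∣ * ∣ y - x ∣          ≡⟨ cong₂ (λ u v → 2 * u + v * v) (*-comm y x) (∣-∣-comm y x) ⟩
  2 * (x * y) + ∣ x - y ∣ * ∣ x - y ∣          ∎
  where open ≡-Reasoning

two-mul-≤-sum-of-squares : ∀ x y → 2 * (x * y) ≤ x * x + y * y
two-mul-≤-sum-of-squares x y =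
  ≤-trans (m≤m+n _ _) (≤-reflexive (sym (sum-of-squares x y)))

parallelogram-law : ∀ x y → (x + y) * (x + y) + ∣ x - y ∣ * ∣ x - y ∣ ≡ 2 * (x * x) + 2 * (y * y)
parallelogram-law x y = begin
  (x + y) * (x + y) + g * g              ≡⟨ expand x y g ⟩
  x * x + y * y + (2 * (x * y) + g * g)  ≡⟨ cong (x * x + y * y +_) (sum-of-squares x y) ⟨
  x * x + y * y + (x * x + y * y)        ≡⟨ regroup (x * x) (y * y) ⟩
  2 * (x * x) + 2 * (y * y)              ∎
  where
  open ≡-Reasoning
  g = ∣ x - y ∣
  expand : ∀ x y g → (x + y) * (x + y) + g * g ≡ x * x + y * y + (2 * (x * y) + g * g)
  expand x y g = solve (x ∷ y ∷ g ∷ [])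
  regroup : ∀ a b → a + b + (a + b) ≡ 2 * a + 2 * b
  regroup a b = solve (a ∷ b ∷ [])

*-self-cancel-< : ∀ {x y} → x * x < y * y → x < y
*-self-cancel-< {x} {y} x²<y² = ≰⇒> λ y≤x → <⇒≱ x²<y² (*-mono-≤ y≤x y≤x)

module _ {A : Set} where

  sum-map-+ : ∀ (f g : A → ℕ) xs → sum (map (λ a → f a + g a) xs) ≡ sum (map f xs) + sum (map g xs)
  sum-map-+ f g [] = refl
  sum-map-+ f g (x ∷ xs) = begin
    f x + g x + sum (map (λ a → f a + g a) xs)    ≡⟨ cong (f x + g x +_) (sum-map-+ f g xs) ⟩
    f x + g x + (sum (map f xs) + sum (map g xs))  ≡⟨ interchange (f x) (g x) _ _ ⟩
    f x + sum (map f xs) + (g x + sum (map g xs))  ∎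
    where open ≡-Reasoning

  sum-map-*ˡ : ∀ c (f : A → ℕ) xs → sum (map (λ a → c * f a) xs) ≡ c * sum (map f xs)
  sum-map-*ˡ c f [] = sym (*-zeroʳ c)
  sum-map-*ˡ c f (x ∷ xs) =
    trans (cong (c * f x +_) (sum-map-*ˡ c f xs)) (sym (*-distribˡ-+ c (f x) _))

  sum-map-mono-≤ : ∀ {f g : A → ℕ} → (∀ a → f a ≤ g a) → ∀ xs → sum (map f xs) ≤ sum (map g xs)
  sum-map-mono-≤ f≤g [] = z≤n
  sum-map-mono-≤ f≤g (x ∷ xs) = +-mono-≤ (f≤g x) (sum-map-mono-≤ f≤g xs)

  sum-map-filter-≤ : ∀ {P : Pred A 0ℓ} (P? : Decidable P) (f : A → ℕ) xs →
    sum (map f (filter P? xs)) ≤ sum (map f xs)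
  sum-map-filter-≤ P? f [] = z≤n
  sum-map-filter-≤ P? f (x ∷ xs) with P? x
  ... | yes _ = +-monoʳ-≤ (f x) (sum-map-filter-≤ P? f xs)
  ... | no _ = ≤-trans (sum-map-filter-≤ P? f xs) (m≤n+m _ (f x))

  sum-map-squares-≤ : ∀ (f : A → ℕ) xs → sum (map (λ a → f a * f a) xs) ≤ sum (map f xs) * sum (map f xs)
  sum-map-squares-≤ f [] = z≤n
  sum-map-squares-≤ f (x ∷ xs) = begin
    f x * f x + sum (map (λ a → f a * f a) xs)   ≤⟨ +-monoʳ-≤ (f x * f x) (sum-map-squares-≤ f xs) ⟩
    f x * f x + S * S                             ≤⟨ m≤m+n _ _ ⟩
    f x * f x + S * S + 2 * (f x * S)             ≡⟨ square-expansion (f x) S ⟩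
    (f x + S) * (f x + S)                         ∎
    where
    open ≤-Reasoning
    S = sum (map f xs)
    square-expansion : ∀ a b → a * a + b * b + 2 * (a * b) ≡ (a + b) * (a + b)
    square-expansion a b = solve (a ∷ b ∷ [])

  cauchy-schwarz : ∀ (f : A → ℕ) xs → sum (map f xs) * sum (map f xs) ≤ length xs * sum (map (λ a → f a * f a) xs)
  cauchy-schwarz f [] = z≤n
  cauchy-schwarz f (x ∷ xs) = begin
    (y + S) * (y + S)                       ≡⟨ expand y S ⟩
    y * y + 2 * (y * S) + S * S             ≤⟨ +-mono-≤ (+-monoʳ-≤ (y * y) (two-mul-≤ xs)) (cauchy-schwarz f xs) ⟩
    y * y + (n * (y * y) + Q) + n * Q       ≡⟨ regroup (y * y) n Q ⟩
    suc n * (y * y + Q)                     ∎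
    where
    open ≤-Reasoning
    y = f x
    S = sum (map f xs)
    Q = sum (map (λ a → f a * f a) xs)
    n = length xs
    two-mul-≤ : ∀ xs → 2 * (y * sum (map f xs)) ≤ length xs * (y * y) + sum (map (λ a → f a * f a) xs)
    two-mul-≤ [] = ≤-reflexive (cong (2 *_) (*-zeroʳ y))
    two-mul-≤ (z ∷ zs) = begin
      2 * (y * (f z + sum (map f zs)))                        ≡⟨ distrib y (f z) _ ⟩
      2 * (y * f z) + 2 * (y * sum (map f zs))                ≤⟨ +-mono-≤ (two-mul-≤-sum-of-squares y (f z)) (two-mul-≤ zs) ⟩
      (y * y + f z * f z) + (length zs * (y * y) + sum (map (λ a → f a * f a) zs))
                                                              ≡⟨ shuffle (y * y) (f z * f z) (length zs) _ ⟩
      suc (length zs) * (y * y) + (f z * f z + sum (map (λ a → f a * f a) zs)) ∎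
      where
      distrib : ∀ a b c → 2 * (a * (b + c)) ≡ 2 * (a * b) + 2 * (a * c)
      distrib a b c = solve (a ∷ b ∷ c ∷ [])
      shuffle : ∀ a b m c → (a + b) + (m * a + c) ≡ suc m * a + (b + c)
      shuffle a b m c = solve (a ∷ b ∷ m ∷ c ∷ [])
    expand : ∀ a b → (a + b) * (a + b) ≡ a * a + 2 * (a * b) + b * b
    expand a b = solve (a ∷ b ∷ [])
    regroup : ∀ a m c → a + (m * a + c) + m * c ≡ suc m * (a + c)
    regroup a m c = solve (a ∷ m ∷ c ∷ [])

module _ {k : ℕ} where

  hist-++ : ∀ (a : Fin k) u v → hist a (u ++ v) ≡ hist a u + hist a v
  hist-++ a u v =
    trans (cong length (filter-++ (a ≟_) u v)) (length-++ (filter (a ≟_) u))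

  ∈⇒0<hist : ∀ {a : Fin k} {u} → a ∈ u → 0 < hist a u
  ∈⇒0<hist {a} {x ∷ u} a∈x∷u with a ≟ x | a∈x∷u
  ... | yes _ | _ = s≤s z≤n
  ... | no a≢x | here a≡x = ⊥-elim (a≢x a≡x)
  ... | no _ | there a∈u = ∈⇒0<hist a∈u

sum-map-hist-singleton : ∀ {k} (x : Fin k) → sum (map (λ a → hist a (x ∷ [])) (allFin k)) ≡ 1
sum-map-hist-singleton {k} x = begin
  sum (map (λ a → hist a (x ∷ [])) (allFin k)) ≡⟨ cong sum (map-tabulate (λ a → a) (λ a → hist a (x ∷ []))) ⟩
  sum (tabulate (λ a → hist a (x ∷ [])))       ≡⟨ sum-tabulate-singleton x ⟩
  1                                             ∎
  where
  open ≡-Reasoning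
  sum-tabulate-zero : ∀ n → sum (tabulate {n = n} (λ _ → 0)) ≡ 0
  sum-tabulate-zero zero = refl
  sum-tabulate-zero (suc n) = sum-tabulate-zero n
  hist-suc : ∀ {k} (a x : Fin k) → hist (suc a) (suc x ∷ []) ≡ hist a (x ∷ [])
  hist-suc a x with a ≟ x
  ... | yes _ = refl
  ... | no _ = refl
  sum-tabulate-singleton : ∀ {k} (x : Fin k) → sum (tabulate (λ a → hist a (x ∷ []))) ≡ 1
  sum-tabulate-singleton {suc k} zero = cong suc (sum-tabulate-zero k)
  sum-tabulate-singleton {suc k} (suc x) =
    trans (cong sum (tabulate-cong (λ a → hist-suc a x))) (sum-tabulate-singleton x)

sum-map-hist≡length : ∀ {k} (u : Str k) → sum (map (λ a → hist a u) (allFin k)) ≡ length u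
sum-map-hist≡length {k} [] = sum-map-zero (allFin k)
  where
  sum-map-zero : ∀ (xs : List (Fin k)) → sum (map (λ _ → 0) xs) ≡ 0
  sum-map-zero [] = refl
  sum-map-zero (_ ∷ xs) = sum-map-zero xs
sum-map-hist≡length {k} (x ∷ u) = begin
  sum (map (λ a → hist a (x ∷ u)) (allFin k))
    ≡⟨ cong sum (map-cong (λ a → hist-++ a (x ∷ []) u) (allFin k)) ⟩
  sum (map (λ a → hist a (x ∷ []) + hist a u) (allFin k))
    ≡⟨ sum-map-+ _ _ (allFin k) ⟩
  sum (map (λ a → hist a (x ∷ [])) (allFin k)) + sum (map (λ a → hist a u) (allFin k))
    ≡⟨ cong₂ _+_ (sum-map-hist-singleton x) (sum-map-hist≡length u) ⟩
  suc (length u) ∎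
  where open ≡-Reasoning

length-filter-allFin-≤ : ∀ {k} {P : Pred (Fin k) 0ℓ} (P? : Decidable P) (w : Str k) →
  (∀ {a} → P a → a ∈ w) → length (filter P? (allFin k)) ≤ length w
length-filter-allFin-≤ {k} P? w P⊆w = begin
  length (filter P? (allFin k))              ≤⟨ length-filter-≤-sum-hist (allFin k) ⟩
  sum (map (λ a → hist a w) (allFin k))      ≡⟨ sum-map-hist≡length w ⟩
  length w                                   ∎
  where
  open ≤-Reasoning
  length-filter-≤-sum-hist : ∀ xs → length (filter P? xs) ≤ sum (map (λ a → hist a w) xs)
  length-filter-≤-sum-hist [] = z≤n
  length-filter-≤-sum-hist (x ∷ xs) with P? x
  ... | yes Px = +-mono-≤ (∈⇒0<hist (P⊆w Px)) (length-filter-≤-sum-hist xs)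
  ... | no _ = ≤-trans (length-filter-≤-sum-hist xs) (m≤n+m _ _)

module _ {k : ℕ} (s : Str k) where

  take-substr : ∀ i m n → take m (substr i (m + n) s) ≡ substr i m s
  take-substr i m n =
    trans (take-take m (m + n) (drop i s)) (cong (λ z → take z (drop i s)) (m≤n⇒m⊓n≡m (m≤m+n m n)))

  drop-substr : ∀ i m n → drop m (substr i (m + n) s) ≡ substr (i + m) n s
  drop-substr i m n = trans (sym (take-drop n m (drop i s))) (cong (take n) (drop-drop i m s))

  substr-double : ∀ i m → substr i (2 * m) s ≡ substr i (m + m) s
  substr-double i m = cong (λ z → substr i (m + z) s) (+-identityʳ m)

  substr-⊆ : ∀ i m → substr i m s ⊆ s
  substr-⊆ i m = Sublist.lookup (drop-⊆ i s) ∘′ Sublist.lookup (take-⊆ m (drop i s))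

  length-substr-≤ : ∀ i m → length (substr i m s) ≤ m
  length-substr-≤ i m = ≤-trans (≤-reflexive (length-take m (drop i s))) (m⊓n≤m m _)

Στₐ² : ∀ {k} → ℕ → Str k → ℕ
Στₐ² {k} r t = sum (map (λ a → τₐ r a t * τₐ r a t) (allFin k))

module Windows {k : ℕ} (s : Str k) where

  count : Fin k → ℕ → ℕ → ℕ
  count a i L = hist a (substr i L s)

  energy : ℕ → ℕ → ℕ
  energy i L = sum (map (λ a → count a i L * count a i L) (allFin k))

  imbalance : ℕ → ℕ → ℕ
  imbalance i L = Στₐ² L (substr i (2 * L) s)

  count-double : ∀ a i L → count a i (2 * L) ≡ count a i L + count a (i + L) L
  count-double a i L = begin
    hist a (substr i (2 * L) s)                     ≡⟨ cong (hist a) (substr-double s i L) ⟩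
    hist a (substr i (L + L) s)                     ≡⟨ cong (hist a) (take++drop≡id L (substr i (L + L) s)) ⟨
    hist a (take L window ++ drop L window)         ≡⟨ hist-++ a (take L window) (drop L window) ⟩
    hist a (take L window) + hist a (drop L window) ≡⟨ cong₂ (λ u v → hist a u + hist a v) (take-substr s i L L) (drop-substr s i L L) ⟩
    count a i L + count a (i + L) L                 ∎
    where
    open ≡-Reasoning
    window = substr i (L + L) s

  τₐ-window : ∀ a i L → τₐ L a (substr i (2 * L) s) ≡ ∣ count a i L - count a (i + L) L ∣
  τₐ-window a i L rewrite substr-double s i L =
    cong₂ (λ u v → ∣ hist a u - hist a v ∣) (take-substr s i L L) (drop-substr s i L L)

  energy-parallelogram : ∀ i L → energy i (2 * L) + imbalance i L ≡ 2 * energy i L + 2 * energy (i + L) L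
  energy-parallelogram i L = begin
    energy i (2 * L) + imbalance i L
      ≡⟨ sum-map-+ (λ a → count a i (2 * L) * count a i (2 * L)) _ (allFin k) ⟨
    sum (map (λ a → count a i (2 * L) * count a i (2 * L) + τₐ L a (substr i (2 * L) s) * τₐ L a (substr i (2 * L) s)) (allFin k))
      ≡⟨ cong sum (map-cong pointwise (allFin k)) ⟩
    sum (map (λ a → 2 * (count a i L * count a i L) + 2 * (count a (i + L) L * count a (i + L) L)) (allFin k))
      ≡⟨ sum-map-+ _ _ (allFin k) ⟩
    sum (map (λ a → 2 * (count a i L * count a i L)) (allFin k)) + sum (map (λ a → 2 * (count a (i + L) L * count a (i + L) L)) (allFin k))
      ≡⟨ cong₂ _+_ (sum-map-*ˡ 2 _ (allFin k)) (sum-map-*ˡ 2 _ (allFin k)) ⟩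
    2 * energy i L + 2 * energy (i + L) L ∎
    where
    open ≡-Reasoning
    pointwise : ∀ a → count a i (2 * L) * count a i (2 * L) + τₐ L a (substr i (2 * L) s) * τₐ L a (substr i (2 * L) s)
                    ≡ 2 * (count a i L * count a i L) + 2 * (count a (i + L) L * count a (i + L) L)
    pointwise a rewrite count-double a i L | τₐ-window a i L = parallelogram-law (count a i L) (count a (i + L) L)

  energy-≤ : ∀ i L → energy i L ≤ L * L
  energy-≤ i L = begin
    energy i L                                     ≤⟨ sum-map-squares-≤ (λ a → count a i L) (allFin k) ⟩
    total * total                                  ≡⟨ cong (λ z → z * z) (sum-map-hist≡length (substr i L s)) ⟩
    length (substr i L s) * length (substr i L s)  ≤⟨ *-mono-≤ (length-substr-≤ s i L) (length-substr-≤ s i L) ⟩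
    L * L                                          ∎
    where
    open ≤-Reasoning
    total = sum (map (λ a → count a i L) (allFin k))

  module _ (c d : ℕ) where

    Balanced : ℕ → ℕ → Set
    Balanced i L = c * imbalance i L < d * (L * L)

    HasBalancedWindow : ℕ → Set
    HasBalancedWindow W = Σ ℕ λ i → Σ ℕ λ L → W ≤ L × i + 2 * L ≤ length s × Balanced i L

    -- The normalised energy c·energy/L² lies in [0, c]; this says m doublings have each lowered it by d/4.
    EnergyBound : ℕ → ℕ → ℕ → Set
    EnergyBound m i L = 4 * c * energy i L + m * d * (L * L) ≤ 4 * c * (L * L)

    energy-bound-zero : ∀ i L → EnergyBound 0 i L
    energy-bound-zero i L = ≤-trans (≤-reflexive (+-identityʳ _)) (*-monoʳ-≤ (4 * c) (energy-≤ i L))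

    energy-bound-double : ∀ m i L → d * (L * L) ≤ c * imbalance i L →
      EnergyBound m i L → EnergyBound m (i + L) L → EnergyBound (suc m) i (2 * L)
    energy-bound-double m i L unbalanced left right = begin
      4 * c * E + suc m * d * (2 * L * (2 * L))
        ≡⟨ expand c E m d L ⟩
      4 * c * E + 4 * (d * (L * L)) + 2 * Y + 2 * Y
        ≤⟨ +-monoˡ-≤ _ (+-monoˡ-≤ _ (+-monoʳ-≤ (4 * c * E) (*-monoʳ-≤ 4 unbalanced))) ⟩
      4 * c * E + 4 * (c * imbalance i L) + 2 * Y + 2 * Y
        ≡⟨ factor c E (imbalance i L) Y ⟩
      4 * c * (E + imbalance i L) + 2 * Y + 2 * Y
        ≡⟨ cong (λ z → 4 * c * z + 2 * Y + 2 * Y) (energy-parallelogram i L) ⟩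
      4 * c * (2 * energy i L + 2 * energy (i + L) L) + 2 * Y + 2 * Y
        ≡⟨ split c (energy i L) (energy (i + L) L) Y ⟩
      2 * (4 * c * energy i L + Y) + 2 * (4 * c * energy (i + L) L + Y)
        ≤⟨ +-mono-≤ (*-monoʳ-≤ 2 left) (*-monoʳ-≤ 2 right) ⟩
      2 * (4 * c * (L * L)) + 2 * (4 * c * (L * L))
        ≡⟨ recombine c L ⟩
      4 * c * (2 * L * (2 * L)) ∎
      where
      open ≤-Reasoning
      E = energy i (2 * L)
      Y = m * d * (L * L)
      expand : ∀ c E m d L → 4 * c * E + suc m * d * (2 * L * (2 * L))
                             ≡ 4 * c * E + 4 * (d * (L * L)) + 2 * (m * d * (L * L)) + 2 * (m * d * (L * L))
      expand c E m d L = solve (c ∷ E ∷ m ∷ d ∷ L ∷ [])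
      factor : ∀ c E D Y → 4 * c * E + 4 * (c * D) + 2 * Y + 2 * Y ≡ 4 * c * (E + D) + 2 * Y + 2 * Y
      factor c E D Y = solve (c ∷ E ∷ D ∷ Y ∷ [])
      split : ∀ c l r Y → 4 * c * (2 * l + 2 * r) + 2 * Y + 2 * Y ≡ 2 * (4 * c * l + Y) + 2 * (4 * c * r + Y)
      split c l r Y = solve (c ∷ l ∷ r ∷ Y ∷ [])
      recombine : ∀ c L → 2 * (4 * c * (L * L)) + 2 * (4 * c * (L * L)) ≡ 4 * c * (2 * L * (2 * L))
      recombine c L = solve (c ∷ L ∷ [])

    balanced-or-double : ∀ W m i L → W ≤ L → i + 2 * L ≤ length s →
      (∀ j → j + L ≤ length s → HasBalancedWindow W ⊎ EnergyBound m j L) →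
      HasBalancedWindow W ⊎ EnergyBound (suc m) i (2 * L)
    balanced-or-double W m i L W≤L fits halves with c * imbalance i L <? d * (L * L)
    ... | yes balanced = inj₁ (i , L , W≤L , fits , balanced)
    ... | no unbalanced with halves i left-fits | halves (i + L) right-fits
      where
      left-fits : i + L ≤ length s
      left-fits = ≤-trans (+-monoʳ-≤ i (m≤m+n L (L + 0))) fits
      right-fits : i + L + L ≤ length s
      right-fits = ≤-trans (≤-reflexive (+-assoc i L L)) (≤-trans (+-monoʳ-≤ i (+-monoʳ-≤ L (m≤m+n L 0))) fits)
    ... | inj₁ found | _ = inj₁ found
    ... | inj₂ _ | inj₁ found = inj₁ found
    ... | inj₂ left | inj₂ right = inj₂ (energy-bound-double m i L (≮⇒≥ unbalanced) left right)

    balanced-or-energy-bound : ∀ W m i → i + 2 ^ m * W ≤ length s →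
      HasBalancedWindow W ⊎ EnergyBound m i (2 ^ m * W)
    balanced-or-energy-bound W zero i _ = inj₂ (energy-bound-zero i (1 * W))
    balanced-or-energy-bound W (suc m) i fits rewrite *-assoc 2 (2 ^ m) W =
      balanced-or-double W m i (2 ^ m * W) (m≤n*m W (2 ^ m) {{m^n≢0 2 m}}) fits
        (balanced-or-energy-bound W m)

    balanced-window : ∀ W .{{_ : NonZero W}} .{{_ : NonZero d}} →
      length s ≡ 2 ^ suc (4 * c) * W → HasBalancedWindow W
    balanced-window W len with balanced-or-energy-bound W M 0 (≤-reflexive (sym len))
      where M = suc (4 * c)
    ... | inj₁ found = found
    ... | inj₂ bound = ⊥-elim (<⇒≱ 4c<Md (*-cancelʳ-≤ (M * d) (4 * c) (X * X) {{X*X≢0}} Md·X²≤4c·X²))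
      where
      M = suc (4 * c)
      X = 2 ^ M * W
      X*X≢0 : NonZero (X * X)
      X*X≢0 = m*n≢0 X X {{X≢0}} {{X≢0}}
        where X≢0 = m*n≢0 (2 ^ M) W {{m^n≢0 2 M}}
      Md·X²≤4c·X² : M * d * (X * X) ≤ 4 * c * (X * X)
      Md·X²≤4c·X² = ≤-trans (m≤n+m _ _) bound
      4c<Md : 4 * c < M * d
      4c<Md = <-≤-trans (n<1+n (4 * c)) (m≤m*n M d)

τ*τ≤length*Στₐ² : ∀ {k} r (t w : Str k) → t ⊆ w → τ r t * τ r t ≤ length w * Στₐ² r t
τ*τ≤length*Στₐ² {k} r t w t⊆w = begin
  τ r t * τ r t                                      ≤⟨ cauchy-schwarz g present ⟩
  length present * sum (map (λ a → g a * g a) present) ≤⟨ *-mono-≤ (length-filter-allFin-≤ P? w t⊆w)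
                                                                   (sum-map-filter-≤ P? (λ a → g a * g a) (allFin k)) ⟩
  length w * Στₐ² r t                                ∎
  where
  open ≤-Reasoning
  g : Fin k → ℕ
  g a = τₐ r a t
  P? = λ a → any? (a ≟_) t
  present = filter P? (allFin k)

module _ {k ℓ : ℕ} {s : Str k} (periodic : Periodic ℓ s) (ℓ≤n : ℓ ≤ length s) where
  open Windows s using (imbalance)

  τ*τ≤ℓ*imbalance : ∀ i r → τ r (substr i (2 * r) s) * τ r (substr i (2 * r) s) ≤ ℓ * imbalance i r
  τ*τ≤ℓ*imbalance i r = ≤-trans (τ*τ≤length*Στₐ² r _ (substr 0 ℓ s) window⊆prefix)
                                (*-monoˡ-≤ _ (length-substr-≤ s 0 ℓ))
    where
    window⊆prefix : substr i (2 * r) s ⊆ substr 0 ℓ s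
    window⊆prefix a∈window = periodic 0 ℓ≤n _ (substr-⊆ s i (2 * r) a∈window)

  balanced⇒τ-≤ : ∀ p q i r → q * q * ℓ * imbalance i r < p * p * (r * r) → q * τ r (substr i (2 * r) s) ≤ p * r
  balanced⇒τ-≤ p q i r balanced = <⇒≤ (*-self-cancel-< (begin-strict
    q * T * (q * T)            ≡⟨ square-product q T ⟩
    q * q * (T * T)            ≤⟨ *-monoʳ-≤ (q * q) (τ*τ≤ℓ*imbalance i r) ⟩
    q * q * (ℓ * imbalance i r) ≡⟨ *-assoc (q * q) ℓ _ ⟨
    q * q * ℓ * imbalance i r  <⟨ balanced ⟩
    p * p * (r * r)            ≡⟨ square-product p r ⟨
    p * r * (p * r)            ∎))
    where
    open ≤-Reasoning
    T = τ r (substr i (2 * r) s)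
    square-product : ∀ x y → x * y * (x * y) ≡ x * x * (y * y)
    square-product x y = solve (x ∷ y ∷ [])

lemma2 : (r₀ ℓ : ℕ) → 0 < r₀ → 0 < ℓ → (p q : ℕ) → 0 < p → 0 < q →
    Σ ℕ λ n → 0 < n ×
      ((k : ℕ) (s : Str k) → length s ≡ n → Periodic ℓ s →
        Σ ℕ λ i → Σ ℕ λ r → r₀ ≤ r × i + 2 * r ≤ n ×
          q * τ r (substr i (2 * r) s) ≤ p * r)
lemma2 r₀ ℓ 0<r₀ 0<ℓ p q 0<p 0<q = n , >-nonZero⁻¹ n {{n≢0}} , window
  where
  c = q * q * ℓ
  d = p * p
  W = r₀ * ℓ
  n = 2 ^ suc (4 * c) * W
  instance
    W≢0 : NonZero W
    W≢0 = m*n≢0 r₀ ℓ {{>-nonZero 0<r₀}} {{>-nonZero 0<ℓ}}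
    d≢0 : NonZero d
    d≢0 = m*n≢0 p p {{>-nonZero 0<p}} {{>-nonZero 0<p}}
  n≢0 : NonZero n
  n≢0 = m*n≢0 (2 ^ suc (4 * c)) W {{m^n≢0 2 (suc (4 * c))}}
  W≤n : W ≤ n
  W≤n = m≤n*m W (2 ^ suc (4 * c)) {{m^n≢0 2 (suc (4 * c))}}
  window : (k : ℕ) (s : Str k) → length s ≡ n → Periodic ℓ s →
    Σ ℕ λ i → Σ ℕ λ r → r₀ ≤ r × i + 2 * r ≤ n × q * τ r (substr i (2 * r) s) ≤ p * r
  window k s len periodic with Windows.balanced-window s c d W len
  ... | i , r , W≤r , fits , balanced =
    i , r , ≤-trans (m≤m*n r₀ ℓ {{>-nonZero 0<ℓ}}) W≤r , ≤-trans fits (≤-reflexive len) ,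
    balanced⇒τ-≤ periodic ℓ≤length p q i r balanced
    where
    ℓ≤length : ℓ ≤ length s
    ℓ≤length = ≤-trans (m≤n*m ℓ r₀ {{>-nonZero 0<r₀}}) (≤-trans W≤n (≤-reflexive (sym len)))
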